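{- Let $p$ be a prime and $r > 1$ an integer, and let $n = p^r$. Then the packing chromatic number of the unitary Cayley graph $G_{\mathbb{Z}_n}$ is \[ \chi_\rho(G_{\mathbb{Z}_n}) = p^r - p^{r-1} + 1. \]
   Context: The unitary Cayley graph $G_{\mathbb{Z}_n}$ of the ring $\mathbb{Z}_n$ has vertex set $\mathbb{Z}_n$, with $x$ and $y$ adjacent if and only if $x-y$ is a unit of $\mathbb{Z}_n$ (i.e. $\gcd(x-y,n)=1$). A packing $k$-coloring of a graph $G$ is a partition of $V(G)$ into $k$ nonempty classes $V_1,\dots,V_k$ such that for each $i\in[k]$, any two distinct vertices $u,v\in V_i$ satisfy $d_G(u,v)\geq i+1$ (where $d_G$ is the shortest-path distance). The packing chromatic number $\chi_\rho(G)$ is the smallest $k$ for which $G$ admits a packing $k$-coloring. -}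

module Defs where

open import Data.Nat using (ℕ; zero; suc; _≤_; ∣_-_∣)
open import Data.Nat.Coprimality using (Coprime)
open import Data.Fin using (Fin; toℕ)
open import Data.Product using (Σ; ∃; _×_)
open import Relation.Nullary using (¬_)
open import Relation.Binary.PropositionalEquality using (_≡_)
open import Function.Definitions using (Surjective)

-- Unitary Cayley graph of ℤ_n: vertices Fin n (residues 0..n-1),
-- x ~ y iff x - y is a unit of ℤ_n, i.e. gcd(|x - y|, n) = 1.
UnitaryAdj : (n : ℕ) → Fin n → Fin n → Set
UnitaryAdj n x y = Coprime ∣ toℕ x - toℕ y ∣ n

data Walk (n : ℕ) : ℕ → Fin n → Fin n → Set where
  here : ∀ {u} → Walk n zero u u
  step : ∀ {k u v w} → UnitaryAdj n u v → Walk n k v w → Walk n (suc k) u w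

-- d(u,v) ≥ m  iff there is no walk from u to v of length < m
-- (covers d = ∞ for disconnected pairs).
DistAtLeast : (n : ℕ) → ℕ → Fin n → Fin n → Set
DistAtLeast n m u v = ∀ k → suc k ≤ m → ¬ Walk n k u v

-- Packing k-coloring: c : V → Fin k, class index i = toℕ (c u) + 1,
-- all k classes nonempty (c surjective), and distinct u,v in class i
-- satisfy d(u,v) ≥ i + 1.
IsPackingColoring : (n k : ℕ) → (Fin n → Fin k) → Set
IsPackingColoring n k c =
  Surjective _≡_ _≡_ c ×
  (∀ u v → c u ≡ c v → ¬ (u ≡ v) → DistAtLeast n (suc (suc (toℕ (c u)))) u v)

HasPackingColoring : (n k : ℕ) → Set
HasPackingColoring n k = Σ (Fin n → Fin k) (IsPackingColoring n k)

PackingChromaticNumberIs : (n m : ℕ) → Set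
PackingChromaticNumberIs n m =
  HasPackingColoring n m × (∀ k → HasPackingColoring n k → m ≤ k)

-- Two residues x, y are adjacent iff p ∤ x − y, so the graph is complete multipartite: its parts
-- are the p residue classes mod p, each of size p^(r−1), and it has diameter 2.  In a packing
-- colouring every colour other than the first therefore occurs at most once, while the first colour
-- class is independent and hence inside one residue class.  Colouring one residue class with the
-- first colour and all other vertices with distinct colours is optimal.
module Submission where

open import Defs
open import Data.Nat
open import Data.Nat.Properties
open import Data.Nat.Divisibility using (_∣_; divides; ∣-trans; ∣1⇒≡1; m∣m*n)
open import Data.Nat.DivMod using (_%_; [m+kn]%n≡m%n; m<n⇒m%n≡m)
open import Data.Nat.Coprimality using (Coprime; coprime-divisor)
open import Data.Nat.Primality using (Prime; prime⇒irreducible; ¬prime[0]; ¬prime[1])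
open import Data.Fin as Fin using (Fin; toℕ; cast; combine; remQuot; punchIn)
import Data.Fin.Properties as Finₚ
open import Data.Product using (∃-syntax; _×_; _,_; proj₁; proj₂; uncurry)
open import Data.Sum using (_⊎_; inj₁; inj₂)
open import Data.Empty using (⊥-elim)
open import Function using (_∘_)
open import Function.Definitions using (Injective; Surjective)
open import Relation.Nullary using (¬_; yes; no)
open import Relation.Binary.PropositionalEquality

¬∣⇒coprime : ∀ {p d} → Prime p → ¬ p ∣ d → Coprime d p
¬∣⇒coprime p-prime p∤d (e∣d , e∣p) with prime⇒irreducible p-prime e∣p
... | inj₁ e≡1 = e≡1
... | inj₂ refl = ⊥-elim (p∤d e∣d)

¬∣⇒coprime-^ : ∀ {p d} → Prime p → ¬ p ∣ d → ∀ r → Coprime d (p ^ r)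
¬∣⇒coprime-^ p-prime p∤d zero (_ , i∣1) = ∣1⇒≡1 i∣1
¬∣⇒coprime-^ p-prime p∤d (suc r) (i∣d , i∣p*pʳ) =
  ¬∣⇒coprime-^ p-prime p∤d r
    (i∣d , coprime-divisor (¬∣⇒coprime p-prime (λ p∣i → p∤d (∣-trans p∣i i∣d))) i∣p*pʳ)

∣⇒¬coprime-^ : ∀ {p d} → Prime p → p ∣ d → ∀ r → ¬ Coprime d (p ^ suc r)
∣⇒¬coprime-^ {p} p-prime p∣d r coprime =
  ¬prime[1] (subst Prime (coprime (p∣d , m∣m*n (p ^ r))) p-prime)

[n*i+j]%n≡j : ∀ n .{{_ : NonZero n}} i {j} → j < n → (n * i + j) % n ≡ j
[n*i+j]%n≡j n i {j} j<n = begin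
  (n * i + j) % n ≡⟨ cong (_% n) (trans (+-comm (n * i) j) (cong (j +_) (*-comm n i))) ⟩
  (j + i * n) % n ≡⟨ [m+kn]%n≡m%n j i n ⟩
  j % n           ≡⟨ m<n⇒m%n≡m j<n ⟩
  j               ∎
  where open ≡-Reasoning

n∣∣n*i+j-n*k+j∣ : ∀ n i j k → n ∣ ∣ n * i + j - n * k + j ∣
n∣∣n*i+j-n*k+j∣ n i j k = subst (n ∣_) (sym difference) (m∣m*n ∣ i - k ∣)
  where
  open ≡-Reasoning
  difference : ∣ n * i + j - n * k + j ∣ ≡ n * ∣ i - k ∣
  difference = begin
    ∣ n * i + j - n * k + j ∣ ≡⟨ cong₂ ∣_-_∣ (+-comm (n * i) j) (+-comm (n * k) j) ⟩
    ∣ j + n * i - j + n * k ∣ ≡⟨ ∣m+n-m+o∣≡∣n-o∣ j (n * i) (n * k) ⟩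
    ∣ n * i - n * k ∣         ≡⟨ *-distribˡ-∣-∣ n i k ⟨
    n * ∣ i - k ∣             ∎

n∣o∸m⇒o%n≡m%n : ∀ {n} .{{_ : NonZero n}} {m o} → m ≤ o → n ∣ o ∸ m → o % n ≡ m % n
n∣o∸m⇒o%n≡m%n {n} {m} {o} m≤o (divides k o∸m≡k*n) = begin
  o % n             ≡⟨ cong (_% n) (m+[n∸m]≡n m≤o) ⟨
  (m + (o ∸ m)) % n ≡⟨ cong (λ x → (m + x) % n) o∸m≡k*n ⟩
  (m + k * n) % n   ≡⟨ [m+kn]%n≡m%n m k n ⟩
  m % n             ∎
  where open ≡-Reasoning

n∣∣m-o∣⇒m%n≡o%n : ∀ {n} .{{_ : NonZero n}} m o → n ∣ ∣ m - o ∣ → m % n ≡ o % n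
n∣∣m-o∣⇒m%n≡o%n {n} m o n∣∣m-o∣ with ≤-total m o
... | inj₁ m≤o = sym (n∣o∸m⇒o%n≡m%n m≤o (subst (n ∣_) (m≤n⇒∣m-n∣≡n∸m m≤o) n∣∣m-o∣))
... | inj₂ o≤m = n∣o∸m⇒o%n≡m%n o≤m
                   (subst (n ∣_) (trans (∣-∣-comm m o) (m≤n⇒∣m-n∣≡n∸m o≤m)) n∣∣m-o∣)

walk-length-0 : ∀ {n} {u v : Fin n} → Walk n 0 u v → u ≡ v
walk-length-0 here = refl

walk-length-1 : ∀ {n} {u v : Fin n} → Walk n 1 u v → UnitaryAdj n u v
walk-length-1 (step u~v here) = u~v

Diameter≤2 : ℕ → Set
Diameter≤2 n = ∀ u v → ∃[ k ] k ≤ 2 × Walk n k u v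

isPackingColoring : ∀ {n k} {c : Fin n → Fin (suc k)} → Surjective _≡_ _≡_ c →
  (∀ u v → c u ≡ c v → u ≢ v → c u ≡ Fin.zero × ¬ UnitaryAdj n u v) →
  IsPackingColoring n (suc k) c
isPackingColoring {n} {c = c} c-surjective colour-classes = c-surjective , separated
  where
  separated : ∀ u v → c u ≡ c v → u ≢ v → DistAtLeast n (2 + toℕ (c u)) u v
  separated u v cu≡cv u≢v with colour-classes u v cu≡cv u≢v
  ... | cu≡0 , u≁v = subst (λ i → DistAtLeast n (2 + toℕ i) u v) (sym cu≡0) far
    where
    far : DistAtLeast n 2 u v
    far 0 _ w = u≢v (walk-length-0 w)
    far 1 _ w = u≁v (walk-length-1 w)
    far (suc (suc _)) (s≤s (s≤s ()))

module _ {n k} {c : Fin n → Fin k} (c-packing : IsPackingColoring n k c) where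

  sameColour⇒¬adjacent : ∀ {u v} → c u ≡ c v → u ≢ v → ¬ UnitaryAdj n u v
  sameColour⇒¬adjacent {u} {v} cu≡cv u≢v u~v =
    proj₂ c-packing u v cu≡cv u≢v 1 (s≤s (s≤s z≤n)) (step u~v here)

  sameColour⇒≡ : Diameter≤2 n → ∀ {u v} → c u ≡ c v → 0 < toℕ (c u) → u ≡ v
  sameColour⇒≡ diameter≤2 {u} {v} cu≡cv 0<cu with u Finₚ.≟ v
  ... | yes u≡v = u≡v
  ... | no u≢v with diameter≤2 u v
  ...   | l , l≤2 , w =
    ⊥-elim (proj₂ c-packing u v cu≡cv u≢v l (≤-trans (s≤s l≤2) (s≤s (s≤s 0<cu))) w)

  -- a has the first colour, and its K neighbours have distinct colours, none of them the first.
  packing-lower-bound : Diameter≤2 n → ∀ {K a} (g : Fin K → Fin n) → Injective _≡_ _≡_ g →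
    (∀ j → g j ≢ a × UnitaryAdj n (g j) a) → toℕ (c a) ≡ 0 → suc K ≤ k
  packing-lower-bound diameter≤2 {K} {a} g g-injective neighbours ca≡0 =
    Finₚ.injective⇒≤ {f = colours} colours-injective
    where
    cg≢ca : ∀ j → c (g j) ≢ c a
    cg≢ca j cg≡ca = sameColour⇒¬adjacent cg≡ca (proj₁ (neighbours j)) (proj₂ (neighbours j))

    0<cg : ∀ j → 0 < toℕ (c (g j))
    0<cg j = n≢0⇒n>0 (λ cg≡0 → cg≢ca j (Finₚ.toℕ-injective (trans cg≡0 (sym ca≡0))))

    colours : Fin (suc K) → Fin k
    colours Fin.zero = c a
    colours (Fin.suc j) = c (g j)

    colours-injective : Injective _≡_ _≡_ colours
    colours-injective {Fin.zero} {Fin.zero} _ = refl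
    colours-injective {Fin.zero} {Fin.suc j} ca≡cg = ⊥-elim (cg≢ca j (sym ca≡cg))
    colours-injective {Fin.suc i} {Fin.zero} cg≡ca = ⊥-elim (cg≢ca i cg≡ca)
    colours-injective {Fin.suc i} {Fin.suc j} cgi≡cgj =
      cong Fin.suc (g-injective (sameColour⇒≡ diameter≤2 cgi≡cgj (0<cg i)))

-- Vertices of ℤ_{p^(r+1)} are written p * q + s with q < p^r and residue s < p.
module PrimePowerModulus (p₀ r : ℕ) (p-prime : Prime (2 + p₀)) where

  p m n : ℕ
  p = 2 + p₀
  m = p ^ r
  n = p * m

  vertex : Fin m → Fin p → Fin n
  vertex q s = cast (*-comm m p) (combine q s)

  coordinates : Fin n → Fin m × Fin p
  coordinates u = remQuot p (cast (*-comm p m) u)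

  quotient : Fin n → Fin m
  quotient = proj₁ ∘ coordinates

  residue : Fin n → Fin p
  residue = proj₂ ∘ coordinates

  coordinates-vertex : ∀ q s → coordinates (vertex q s) ≡ (q , s)
  coordinates-vertex q s =
    trans (cong (remQuot p) (Finₚ.cast-involutive (*-comm p m) (*-comm m p) (combine q s)))
          (Finₚ.remQuot-combine q s)

  vertex-coordinates : ∀ u → vertex (quotient u) (residue u) ≡ u
  vertex-coordinates u =
    trans (cong (cast (*-comm m p)) (Finₚ.combine-remQuot {m} p (cast (*-comm p m) u)))
          (Finₚ.cast-involutive (*-comm m p) (*-comm p m) u)

  coordinates-injective : ∀ {u v} → coordinates u ≡ coordinates v → u ≡ v
  coordinates-injective {u} {v} eq =
    trans (sym (vertex-coordinates u)) (trans (cong (uncurry vertex) eq) (vertex-coordinates v))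

  toℕ-vertex : ∀ q s → toℕ (vertex q s) ≡ p * toℕ q + toℕ s
  toℕ-vertex q s = trans (Finₚ.toℕ-cast (*-comm m p) (combine q s)) (Finₚ.toℕ-combine q s)

  toℕ≡p*quotient+residue : ∀ u → toℕ u ≡ p * toℕ (quotient u) + toℕ (residue u)
  toℕ≡p*quotient+residue u = trans (cong toℕ (sym (vertex-coordinates u))) (toℕ-vertex _ _)

  toℕ%p≡residue : ∀ u → toℕ u % p ≡ toℕ (residue u)
  toℕ%p≡residue u = trans (cong (_% p) (toℕ≡p*quotient+residue u))
                          ([n*i+j]%n≡j p (toℕ (quotient u)) (Finₚ.toℕ<n (residue u)))

  residue≢⇒adjacent : ∀ {u v} → residue u ≢ residue v → UnitaryAdj n u v
  residue≢⇒adjacent {u} {v} residues≢ = ¬∣⇒coprime-^ p-prime p∤∣u-v∣ (suc r)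
    where
    p∤∣u-v∣ : ¬ p ∣ ∣ toℕ u - toℕ v ∣
    p∤∣u-v∣ p∣∣u-v∣ = residues≢ (Finₚ.toℕ-injective (begin
      toℕ (residue u) ≡⟨ toℕ%p≡residue u ⟨
      toℕ u % p       ≡⟨ n∣∣m-o∣⇒m%n≡o%n (toℕ u) (toℕ v) p∣∣u-v∣ ⟩
      toℕ v % p       ≡⟨ toℕ%p≡residue v ⟩
      toℕ (residue v) ∎))
      where open ≡-Reasoning

  residue≡⇒¬adjacent : ∀ {u v} → residue u ≡ residue v → ¬ UnitaryAdj n u v
  residue≡⇒¬adjacent {u} {v} residues≡ = ∣⇒¬coprime-^ p-prime p∣∣u-v∣ r
    where
    p∣∣u-v∣ : p ∣ ∣ toℕ u - toℕ v ∣
    p∣∣u-v∣ = subst (p ∣_) (sym ∣u-v∣≡)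
      (n∣∣n*i+j-n*k+j∣ p (toℕ (quotient u)) (toℕ (residue u)) (toℕ (quotient v)))
      where
      ∣u-v∣≡ : ∣ toℕ u - toℕ v ∣ ≡
        ∣ p * toℕ (quotient u) + toℕ (residue u) - p * toℕ (quotient v) + toℕ (residue u) ∣
      ∣u-v∣≡ = cong₂ ∣_-_∣ (toℕ≡p*quotient+residue u)
        (trans (toℕ≡p*quotient+residue v) (cong (λ s → p * toℕ (quotient v) + toℕ s) (sym residues≡)))

  zeroQuotient : Fin m
  zeroQuotient = Fin.fromℕ< (m^n>0 p r)

  K : ℕ
  K = suc p₀ * m

  outsideCoordinates : Fin p → Fin (suc p₀) × Fin m → Fin m × Fin p
  outsideCoordinates s (t , q) = q , punchIn s t

  outsideClass : Fin p → Fin K → Fin n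
  outsideClass s = uncurry vertex ∘ outsideCoordinates s ∘ remQuot m

  residue-outsideClass : ∀ s j → residue (outsideClass s j) ≢ s
  residue-outsideClass s j eq =
    Finₚ.punchInᵢ≢i s _ (trans (sym (cong proj₂ (coordinates-vertex _ _))) eq)

  outsideCoordinates-injective : ∀ s → Injective _≡_ _≡_ (outsideCoordinates s)
  outsideCoordinates-injective s {t , q} {t′ , q′} eq =
    cong₂ _,_ (Finₚ.punchIn-injective s t t′ (cong proj₂ eq)) (cong proj₁ eq)

  outsideClass-injective : ∀ s → Injective _≡_ _≡_ (outsideClass s)
  outsideClass-injective s {i} {j} eq =
    trans (sym (Finₚ.combine-remQuot {suc p₀} m i))
          (trans (cong (uncurry combine) (outsideCoordinates-injective s same))
                 (Finₚ.combine-remQuot {suc p₀} m j))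
    where
    same : outsideCoordinates s (remQuot m i) ≡ outsideCoordinates s (remQuot m j)
    same = trans (sym (coordinates-vertex _ _)) (trans (cong coordinates eq) (coordinates-vertex _ _))

  diameter≤2 : Diameter≤2 n
  diameter≤2 u v with residue u Finₚ.≟ residue v
  ... | no residues≢ = 1 , s≤s z≤n , step (residue≢⇒adjacent residues≢) here
  ... | yes residues≡ =
    2 , ≤-refl , step (residue≢⇒adjacent (w≢u ∘ sym)) (step (residue≢⇒adjacent w≢v) here)
    where
    w : Fin n
    w = outsideClass (residue u) (combine {suc p₀} Fin.zero zeroQuotient)
    w≢u : residue w ≢ residue u
    w≢u = residue-outsideClass _ _
    w≢v : residue w ≢ residue v
    w≢v = w≢u ∘ (λ eq → trans eq (sym residues≡))

  colour : Fin m × Fin p → Fin (suc K)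
  colour (q , Fin.zero) = Fin.zero
  colour (q , Fin.suc t) = Fin.suc (combine t q)

  colour-fibres : ∀ a b → colour a ≡ colour b → a ≡ b ⊎ (colour a ≡ Fin.zero × proj₂ a ≡ proj₂ b)
  colour-fibres (q , Fin.zero) (q′ , Fin.zero) _ = inj₂ (refl , refl)
  colour-fibres (q , Fin.suc t) (q′ , Fin.suc t′) eq = inj₁
    (cong₂ _,_ (Finₚ.combine-injectiveʳ t q t′ q′ (Finₚ.suc-injective eq))
               (cong Fin.suc (Finₚ.combine-injectiveˡ t q t′ q′ (Finₚ.suc-injective eq))))

  colouring : Fin n → Fin (suc K)
  colouring = colour ∘ coordinates

  colouring-surjective : Surjective _≡_ _≡_ colouring
  colouring-surjective Fin.zero =
    vertex zeroQuotient Fin.zero , λ { refl → cong colour (coordinates-vertex _ _) }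
  colouring-surjective (Fin.suc j) =
    outsideClass Fin.zero j ,
    λ { refl → trans (cong colour (coordinates-vertex _ _))
                     (cong Fin.suc (Finₚ.combine-remQuot {suc p₀} m j)) }

  colouring-isPacking : IsPackingColoring n (suc K) colouring
  colouring-isPacking = isPackingColoring colouring-surjective classes
    where
    classes : ∀ u v → colouring u ≡ colouring v → u ≢ v →
      colouring u ≡ Fin.zero × ¬ UnitaryAdj n u v
    classes u v eq u≢v with colour-fibres (coordinates u) (coordinates v) eq
    ... | inj₁ same = ⊥-elim (u≢v (coordinates-injective same))
    ... | inj₂ (cu≡0 , residues≡) = cu≡0 , residue≡⇒¬adjacent residues≡

  lower-bound : ∀ k → HasPackingColoring n k → suc K ≤ k
  lower-bound zero (c , _) = ⊥-elim (Finₚ.¬Fin0 (c (vertex zeroQuotient Fin.zero)))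
  lower-bound (suc k) (c , c-packing@(c-surjective , _)) =
    packing-lower-bound c-packing diameter≤2 (outsideClass (residue a)) (outsideClass-injective _)
      (λ j → (residue-outsideClass _ j ∘ cong residue) , residue≢⇒adjacent (residue-outsideClass _ j))
      (cong toℕ (proj₂ (c-surjective Fin.zero) refl))
    where
    a : Fin n
    a = proj₁ (c-surjective Fin.zero)

  χρ≡1+K : PackingChromaticNumberIs n (suc K)
  χρ≡1+K = (colouring , colouring-isPacking) , lower-bound

χρ-primePower : ∀ p r → Prime p → PackingChromaticNumberIs (p ^ suc r) (p ^ suc r ∸ p ^ r + 1)
χρ-primePower 0 r p-prime = ⊥-elim (¬prime[0] p-prime)
χρ-primePower 1 r p-prime = ⊥-elim (¬prime[1] p-prime)
χρ-primePower (suc (suc p₀)) r p-prime =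
  -- p * m unfolds to m + K
  subst (PackingChromaticNumberIs n) (sym (trans (cong (_+ 1) (m+n∸m≡n m K)) (+-comm K 1))) χρ≡1+K
  where open PrimePowerModulus p₀ r p-prime

mainTheorem2 : (p r : ℕ) → Prime p → 1 < r →
    PackingChromaticNumberIs (p ^ r) (p ^ r ∸ p ^ (r ∸ 1) + 1)
mainTheorem2 p (suc r) p-prime _ = χρ-primePower p r p-prime
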